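{- Let $G$ be a finite connected simple $(t+1)$-regular graph with $n_V$ vertices and $n_E$ edges. Then, as rational functions of $q$ (for any $u$), \[ \zeta_G(q,1-t-u)=\left(\frac{1-(1-u)^2q^2}{1-(t+u)^2q^2}\right)^{n_E-n_V}\zeta_G(q,u). \] Equivalently, the completed Bartholdi zeta function $\xi_G(q,u)=\bigl(1-(1-u)^2q^2\bigr)^{n_E-\frac{n_V}{2}}\bigl(1-(t+u)^2q^2\bigr)^{\frac{n_V}{2}}\zeta_G(q,u)$ satisfies $\xi_G(q,1-t-u)=\xi_G(q,u)$.
   Context: $A$ is the adjacency matrix of $G$, $D=\mathrm{diag}(\deg v)$, $Q_u=(1-u)\bigl(D-(1-u)I_{n_V}\bigr)$. The Bartholdi zeta function is defined for small $|q|,|u|$ by the Euler product $\zeta_G(q,u)=\prod_{[C]}(1-q^{|C|}u^{b(C)})^{ -1}$ over rotation-equivalence classes of primitive cycles $C$ (closed walks on directed edges), where $|C|$ is the length and $b(C)$ the number of bumps (consecutive traversal of an edge and its reverse, counted cyclically). It is known to equal $(1-(1-u)^2q^2)^{ -(n_E-n_V)}\det(I_{n_V}-qA+q^2Q_u)^{ -1}$, which for a $(t+1)$-regular graph is $(1-(1-u)^2q^2)^{ -(n_E-n_V)}\det\bigl((1+(1-u)(t+u)q^2)I_{n_V}-qA\bigr)^{ -1}$; $\zeta_G(q,u)$ denotes this rational function for all $q,u$. -}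

module Defs where

open import Data.Bool using (Bool; true; false; if_then_else_)
open import Data.Nat as ℕ using (ℕ; zero; suc; _<ᵇ_)
open import Data.Fin using (Fin; zero; suc; toℕ; punchIn)
open import Data.Integer as ℤ using (ℤ; +_; -[1+_])
open import Data.Rational using (ℚ; 0ℚ; 1ℚ; _+_; _*_; _-_; -_; 1/_; _/_; ≢-nonZero)
open import Data.Rational.Properties using (_≟_)
open import Relation.Nullary using (yes; no)
open import Relation.Binary.PropositionalEquality using (_≡_)

∑ℕ : (n : ℕ) → (Fin n → ℕ) → ℕ
∑ℕ zero    f = 0
∑ℕ (suc n) f = f zero ℕ.+ ∑ℕ n (λ i → f (suc i))

∑ℚ : (n : ℕ) → (Fin n → ℚ) → ℚ
∑ℚ zero    f = 0ℚ
∑ℚ (suc n) f = f zero + ∑ℚ n (λ i → f (suc i))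

fromℕ : ℕ → ℚ
fromℕ n = (+ n) / 1

infixr 8 _^ℕ_
_^ℕ_ : ℚ → ℕ → ℚ
x ^ℕ zero  = 1ℚ
x ^ℕ suc n = x * (x ^ℕ n)

-- total inverse (junk value 0 at 0; only used where the argument is nonzero)
inv : ℚ → ℚ
inv x with x ≟ 0ℚ
... | yes _  = 0ℚ
... | no x≢0 = 1/_ x {{≢-nonZero x≢0}}

infixr 8 _^ℤ_
_^ℤ_ : ℚ → ℤ → ℚ
x ^ℤ (+ n)    = x ^ℕ n
x ^ℤ -[1+ n ] = inv (x ^ℕ suc n)

Matrix : ℕ → Set
Matrix n = Fin n → Fin n → ℚ

sign : ℕ → ℚ
sign zero          = 1ℚ
sign (suc zero)    = - 1ℚ
sign (suc (suc k)) = sign k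

det : (n : ℕ) → Matrix n → ℚ
det zero    M = 1ℚ
det (suc n) M =
  ∑ℚ (suc n) (λ j → sign (toℕ j) * M zero j * det n (λ i k → M (suc i) (punchIn j k)))

identity : (n : ℕ) → Matrix n
identity n i j with toℕ i ℕ.≟ toℕ j
... | yes _ = 1ℚ
... | no  _ = 0ℚ

record Graph (n : ℕ) : Set where
  field
    adj   : Fin n → Fin n → Bool
    sym   : ∀ i j → adj i j ≡ adj j i
    irrefl : ∀ i → adj i i ≡ false
open Graph public

bit : Bool → ℕ
bit true  = 1
bit false = 0

degree : ∀ {n} → Graph n → Fin n → ℕ
degree {n} G v = ∑ℕ n (λ w → bit (adj G v w))

numEdges : ∀ {n} → Graph n → ℕ
numEdges {n} G = ∑ℕ n (λ i → ∑ℕ n (λ j → bit (toℕ i <ᵇ toℕ j) ℕ.* bit (adj G i j)))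

data Reach {n : ℕ} (G : Graph n) : Fin n → Fin n → Set where
  here : ∀ {v} → Reach G v v
  step : ∀ {u v w} → adj G u v ≡ true → Reach G v w → Reach G u w

Connected : ∀ {n} → Graph n → Set
Connected {n} G = ∀ (v w : Fin n) → Reach G v w

Regular : ∀ {n} → Graph n → ℕ → Set
Regular {n} G k = ∀ (v : Fin n) → degree G v ≡ k

adjMatrix : ∀ {n} → Graph n → Matrix n
adjMatrix G i j = fromℕ (bit (adj G i j))

degMatrix : ∀ {n} → Graph n → Matrix n
degMatrix {n} G i j = fromℕ (degree G i) * identity n i j

Qmat : ∀ {n} → Graph n → ℚ → Matrix n
Qmat {n} G u i j = (1ℚ - u) * (degMatrix G i j - (1ℚ - u) * identity n i j)

bartholdiMatrix : ∀ {n} → Graph n → ℚ → ℚ → Matrix n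
bartholdiMatrix {n} G q u i j =
  identity n i j - q * adjMatrix G i j + (q * q) * Qmat G u i j

bartholdiDet : ∀ {n} → Graph n → ℚ → ℚ → ℚ
bartholdiDet {n} G q u = det n (bartholdiMatrix G q u)

edgeExcess : ∀ {n} → Graph n → ℤ
edgeExcess {n} G = (+ numEdges G) ℤ.- (+ n)

factor : ℚ → ℚ → ℚ
factor q u = 1ℚ - ((1ℚ - u) ^ℕ 2) * (q ^ℕ 2)

-- Bartholdi zeta function (value of the rational function at (q,u)):
-- (1-(1-u)^2 q^2)^{-(n_E-n_V)} det(I - qA + q^2 Q_u)^{-1}
zeta : ∀ {n} → Graph n → ℚ → ℚ → ℚ
zeta G q u = (factor q u ^ℤ (ℤ.- edgeExcess G)) * inv (bartholdiDet G q u)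

{-# OPTIONS --safe #-}
module Submission where

-- For a (t+1)-regular graph Q_u = (1-u)(t+u) I, and (1-u)(t+u) is invariant
-- under the involution u ↦ 1-t-u; hence so is det(I - qA + q²Q_u). The
-- prefactor f = 1-(1-u)²q² turns into g = 1-(t+u)²q², and g^(-e) = (f/g)^e f^(-e).

open import Defs hiding (sym)
open import Data.Nat using (ℕ; zero; suc)
open import Data.Fin using (Fin; zero; suc; toℕ; punchIn)
open import Data.Integer as ℤ using (ℤ; +_; -[1+_]; 1ℤ)
import Data.Integer.Properties as ℤ
open import Data.Rational using (ℚ; 0ℚ; 1ℚ; _+_; _*_; _-_; toℚᵘ; ≢-nonZero)
open import Data.Rational.Properties
  using (_≟_; 1≢0; *-assoc; *-comm; *-identityˡ; *-identityʳ; *-zeroˡ; *-zeroʳ;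
         *-inverseˡ; toℚᵘ-injective; toℚᵘ-fromℚᵘ; toℚᵘ-homo-+)
import Data.Rational.Unnormalised as ℚᵘ
import Data.Rational.Unnormalised.Properties as ℚᵘ
open import Data.Rational.Solver using (module +-*-Solver)
open import Relation.Binary.PropositionalEquality
  using (_≡_; _≢_; refl; sym; trans; cong; cong₂; module ≡-Reasoning)
open import Relation.Nullary using (Dec; yes; no)
open import Data.Empty using (⊥-elim)

open +-*-Solver

inv-inverseˡ : ∀ {x} → x ≢ 0ℚ → inv x * x ≡ 1ℚ
inv-inverseˡ {x} x≢0 with x ≟ 0ℚ
... | yes x≡0 = ⊥-elim (x≢0 x≡0)
... | no  x≢0 = *-inverseˡ x {{≢-nonZero x≢0}}

inv-inverseʳ : ∀ {x} → x ≢ 0ℚ → x * inv x ≡ 1ℚ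
inv-inverseʳ {x} x≢0 = trans (*-comm x (inv x)) (inv-inverseˡ x≢0)

*-cancelˡ : ∀ {x y z} → x ≢ 0ℚ → x * y ≡ x * z → y ≡ z
*-cancelˡ {x} {y} {z} x≢0 xy≡xz = begin
  y                ≡⟨ sym (*-identityˡ y) ⟩
  1ℚ * y           ≡⟨ cong (_* y) (sym (inv-inverseˡ x≢0)) ⟩
  inv x * x * y    ≡⟨ *-assoc (inv x) x y ⟩
  inv x * (x * y)  ≡⟨ cong (inv x *_) xy≡xz ⟩
  inv x * (x * z)  ≡⟨ *-assoc (inv x) x z ⟨
  inv x * x * z    ≡⟨ cong (_* z) (inv-inverseˡ x≢0) ⟩
  1ℚ * z           ≡⟨ *-identityˡ z ⟩
  z                ∎
  where open ≡-Reasoning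

inv-unique : ∀ x y → x * y ≡ 1ℚ → y ≡ inv x
inv-unique x y xy≡1 = *-cancelˡ x≢0 (trans xy≡1 (sym (inv-inverseʳ x≢0)))
  where
  x≢0 : x ≢ 0ℚ
  x≢0 refl = 1≢0 (trans (sym xy≡1) (*-zeroˡ y))

inv-involutive : ∀ x → inv (inv x) ≡ x
inv-involutive x = by-cases (x ≟ 0ℚ)
  where
  by-cases : Dec (x ≡ 0ℚ) → inv (inv x) ≡ x
  by-cases (yes refl) = refl
  by-cases (no  x≢0)  = sym (inv-unique (inv x) x (inv-inverseˡ x≢0))

inv-≢0 : ∀ {x} → x ≢ 0ℚ → inv x ≢ 0ℚ
inv-≢0 {x} x≢0 inv-x≡0 = 1≢0 (begin
  1ℚ         ≡⟨ sym (inv-inverseˡ x≢0) ⟩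
  inv x * x  ≡⟨ cong (_* x) inv-x≡0 ⟩
  0ℚ * x     ≡⟨ *-zeroˡ x ⟩
  0ℚ         ∎)
  where open ≡-Reasoning

*-≢0 : ∀ {x y} → x ≢ 0ℚ → y ≢ 0ℚ → x * y ≢ 0ℚ
*-≢0 {x} x≢0 y≢0 xy≡0 = y≢0 (*-cancelˡ x≢0 (trans xy≡0 (sym (*-zeroʳ x))))

inv-distrib-* : ∀ x y → inv (x * y) ≡ inv x * inv y
inv-distrib-* x y = by-cases (x ≟ 0ℚ) (y ≟ 0ℚ)
  where
  open ≡-Reasoning
  by-cases : Dec (x ≡ 0ℚ) → Dec (y ≡ 0ℚ) → inv (x * y) ≡ inv x * inv y
  by-cases (yes refl) _          = trans (cong inv (*-zeroˡ y)) (sym (*-zeroˡ (inv y)))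
  by-cases (no  _)    (yes refl) = trans (cong inv (*-zeroʳ x)) (sym (*-zeroʳ (inv x)))
  by-cases (no  x≢0)  (no  y≢0)  = sym (inv-unique (x * y) (inv x * inv y) (begin
    x * y * (inv x * inv y)  ≡⟨ solve 4 (λ x y x⁻¹ y⁻¹ → x :* y :* (x⁻¹ :* y⁻¹)
                                                := (x :* x⁻¹) :* (y :* y⁻¹))
                                       refl x y (inv x) (inv y) ⟩
    x * inv x * (y * inv y)  ≡⟨ cong₂ _*_ (inv-inverseʳ x≢0) (inv-inverseʳ y≢0) ⟩
    1ℚ * 1ℚ                  ≡⟨⟩
    1ℚ                       ∎))

^ℕ-distrib-* : ∀ x y n → (x * y) ^ℕ n ≡ x ^ℕ n * y ^ℕ n
^ℕ-distrib-* x y zero    = refl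
^ℕ-distrib-* x y (suc n) = begin
  x * y * (x * y) ^ℕ n        ≡⟨ cong (x * y *_) (^ℕ-distrib-* x y n) ⟩
  x * y * (x ^ℕ n * y ^ℕ n)   ≡⟨ solve 4 (λ x y xⁿ yⁿ → x :* y :* (xⁿ :* yⁿ)
                                                   := x :* xⁿ :* (y :* yⁿ))
                                          refl x y (x ^ℕ n) (y ^ℕ n) ⟩
  x * x ^ℕ n * (y * y ^ℕ n)   ∎
  where open ≡-Reasoning

^ℕ-≢0 : ∀ {x} n → x ≢ 0ℚ → x ^ℕ n ≢ 0ℚ
^ℕ-≢0 zero    x≢0 = 1≢0
^ℕ-≢0 (suc n) x≢0 = *-≢0 x≢0 (^ℕ-≢0 n x≢0)

inv-^ℕ : ∀ x n → inv x ^ℕ n ≡ inv (x ^ℕ n)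
inv-^ℕ x zero    = refl
inv-^ℕ x (suc n) = trans (cong (inv x *_) (inv-^ℕ x n)) (sym (inv-distrib-* x (x ^ℕ n)))

^ℤ-distrib-* : ∀ x y e → (x * y) ^ℤ e ≡ x ^ℤ e * y ^ℤ e
^ℤ-distrib-* x y (+ n)    = ^ℕ-distrib-* x y n
^ℤ-distrib-* x y -[1+ n ] = trans (cong inv (^ℕ-distrib-* x y (suc n)))
                                  (inv-distrib-* (x ^ℕ suc n) (y ^ℕ suc n))

^ℤ-≢0 : ∀ {x} e → x ≢ 0ℚ → x ^ℤ e ≢ 0ℚ
^ℤ-≢0 (+ n)    x≢0 = ^ℕ-≢0 n x≢0
^ℤ-≢0 -[1+ n ] x≢0 = inv-≢0 (^ℕ-≢0 (suc n) x≢0)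

^ℤ-neg : ∀ x e → x ^ℤ (ℤ.- e) ≡ inv (x ^ℤ e)
^ℤ-neg x (+ zero)  = refl
^ℤ-neg x (+ suc n) = refl
^ℤ-neg x -[1+ n ]  = sym (inv-involutive (x ^ℕ suc n))

inv-^ℤ : ∀ x e → inv x ^ℤ e ≡ inv (x ^ℤ e)
inv-^ℤ x (+ n)    = inv-^ℕ x n
inv-^ℤ x -[1+ n ] = cong inv (inv-^ℕ x (suc n))

y^-e≡[x/y]^e*x^-e : ∀ {x} y e → x ≢ 0ℚ →
                    y ^ℤ (ℤ.- e) ≡ (x * inv y) ^ℤ e * x ^ℤ (ℤ.- e)
y^-e≡[x/y]^e*x^-e {x} y e x≢0 = sym (begin
  (x * inv y) ^ℤ e * x ^ℤ (ℤ.- e)      ≡⟨ cong₂ _*_ (^ℤ-distrib-* x (inv y) e) (^ℤ-neg x e) ⟩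
  x ^ℤ e * inv y ^ℤ e * inv (x ^ℤ e)   ≡⟨ solve 3 (λ a b a⁻¹ → a :* b :* a⁻¹ := b :* (a :* a⁻¹))
                                                 refl (x ^ℤ e) (inv y ^ℤ e) (inv (x ^ℤ e)) ⟩
  inv y ^ℤ e * (x ^ℤ e * inv (x ^ℤ e)) ≡⟨ cong (inv y ^ℤ e *_) (inv-inverseʳ (^ℤ-≢0 e x≢0)) ⟩
  inv y ^ℤ e * 1ℚ                      ≡⟨ *-identityʳ (inv y ^ℤ e) ⟩
  inv y ^ℤ e                           ≡⟨ inv-^ℤ y e ⟩
  inv (y ^ℤ e)                         ≡⟨ sym (^ℤ-neg y e) ⟩
  y ^ℤ (ℤ.- e)                         ∎)
  where open ≡-Reasoning

∑ℚ-cong : ∀ n {f g : Fin n → ℚ} → (∀ i → f i ≡ g i) → ∑ℚ n f ≡ ∑ℚ n g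
∑ℚ-cong zero    f≗g = refl
∑ℚ-cong (suc n) f≗g = cong₂ _+_ (f≗g zero) (∑ℚ-cong n (λ i → f≗g (suc i)))

det-cong : ∀ n {M N : Matrix n} → (∀ i j → M i j ≡ N i j) → det n M ≡ det n N
det-cong zero    M≗N = refl
det-cong (suc n) M≗N = ∑ℚ-cong (suc n) λ j →
  cong₂ (λ a b → sign (toℕ j) * a * b)
        (M≗N zero j) (det-cong n (λ i k → M≗N (suc i) (punchIn j k)))

fromℕ-suc : ∀ n → fromℕ (suc n) ≡ 1ℚ + fromℕ n
fromℕ-suc n = toℚᵘ-injective (begin
  toℚᵘ (fromℕ (suc n))               ≈⟨ toℚᵘ-fromℚᵘ (ℚᵘ.mkℚᵘ (+ suc n) 0) ⟩
  ℚᵘ.mkℚᵘ (+ suc n) 0                ≈⟨ ℚᵘ.*≡* (cong (λ m → (1ℤ ℤ.+ m) ℤ.* 1ℤ)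
                                                     (sym (ℤ.*-identityʳ (+ n)))) ⟩
  toℚᵘ 1ℚ ℚᵘ.+ ℚᵘ.mkℚᵘ (+ n) 0       ≈⟨ ℚᵘ.+-congʳ (toℚᵘ 1ℚ) (toℚᵘ-fromℚᵘ (ℚᵘ.mkℚᵘ (+ n) 0)) ⟨
  toℚᵘ 1ℚ ℚᵘ.+ toℚᵘ (fromℕ n)        ≈⟨ toℚᵘ-homo-+ 1ℚ (fromℕ n) ⟨
  toℚᵘ (1ℚ + fromℕ n)                ∎)
  where open ℚᵘ.≃-Reasoning

Qmat-regular : ∀ {n t} (G : Graph n) → Regular G (suc t) →
               ∀ u i j → Qmat G u i j ≡ (1ℚ - u) * (fromℕ t + u) * identity n i j
Qmat-regular {n} {t} G regular u i j = begin
  (1ℚ - u) * (fromℕ (degree G i) * δ - (1ℚ - u) * δ)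
    ≡⟨ cong (λ d → (1ℚ - u) * (d * δ - (1ℚ - u) * δ))
            (trans (cong fromℕ (regular i)) (fromℕ-suc t)) ⟩
  (1ℚ - u) * ((1ℚ + fromℕ t) * δ - (1ℚ - u) * δ)
    ≡⟨ solve 3 (λ T u δ → (con 1ℚ :- u) :* ((con 1ℚ :+ T) :* δ :- (con 1ℚ :- u) :* δ)
                      := (con 1ℚ :- u) :* (T :+ u) :* δ)
             refl (fromℕ t) u δ ⟩
  (1ℚ - u) * (fromℕ t + u) * δ ∎
  where
  open ≡-Reasoning
  δ : ℚ
  δ = identity n i j

Qmat-reflect : ∀ {n t} (G : Graph n) → Regular G (suc t) →
               ∀ u i j → Qmat G ((1ℚ - fromℕ t) - u) i j ≡ Qmat G u i j
Qmat-reflect {n} {t} G regular u i j = begin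
  Qmat G u′ i j
    ≡⟨ Qmat-regular G regular u′ i j ⟩
  (1ℚ - u′) * (fromℕ t + u′) * identity n i j
    ≡⟨ cong (_* identity n i j)
            (solve 2 (λ T u → (con 1ℚ :- ((con 1ℚ :- T) :- u)) :* (T :+ ((con 1ℚ :- T) :- u))
                           := (con 1ℚ :- u) :* (T :+ u))
                     refl (fromℕ t) u) ⟩
  (1ℚ - u) * (fromℕ t + u) * identity n i j
    ≡⟨ Qmat-regular G regular u i j ⟨
  Qmat G u i j ∎
  where
  open ≡-Reasoning
  u′ : ℚ
  u′ = (1ℚ - fromℕ t) - u

bartholdiDet-reflect : ∀ {n t} (G : Graph n) → Regular G (suc t) →
                       ∀ q u → bartholdiDet G q ((1ℚ - fromℕ t) - u) ≡ bartholdiDet G q u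
bartholdiDet-reflect {n} G regular q u = det-cong n λ i j →
  cong (λ Q → identity n i j - q * adjMatrix G i j + q * q * Q) (Qmat-reflect G regular u i j)

factor-reflect : ∀ T q u → factor q ((1ℚ - T) - u) ≡ 1ℚ - (T + u) ^ℕ 2 * q ^ℕ 2
factor-reflect T q u = cong (λ v → 1ℚ - v ^ℕ 2 * q ^ℕ 2)
  (solve 2 (λ T u → con 1ℚ :- ((con 1ℚ :- T) :- u) := T :+ u) refl T u)

theorem3p4 : (t nV : ℕ) (G : Graph nV) → Connected G → Regular G (suc t) →
  (q u : ℚ) →
  factor q u ≢ 0ℚ →
  (1ℚ - ((fromℕ t + u) ^ℕ 2) * (q ^ℕ 2)) ≢ 0ℚ →
  bartholdiDet G q u ≢ 0ℚ →
  bartholdiDet G q ((1ℚ - fromℕ t) - u) ≢ 0ℚ →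
  zeta G q ((1ℚ - fromℕ t) - u)
    ≡ ((factor q u * inv (1ℚ - ((fromℕ t + u) ^ℕ 2) * (q ^ℕ 2))) ^ℤ edgeExcess G)
      * zeta G q u
theorem3p4 t nV G _ regular q u f≢0 _ _ _ = begin
  factor q u′ ^ℤ (ℤ.- e) * inv (bartholdiDet G q u′)
    ≡⟨ cong₂ (λ a d → a ^ℤ (ℤ.- e) * inv d)
             (factor-reflect (fromℕ t) q u) (bartholdiDet-reflect G regular q u) ⟩
  g ^ℤ (ℤ.- e) * inv (bartholdiDet G q u)
    ≡⟨ cong (_* inv (bartholdiDet G q u)) (y^-e≡[x/y]^e*x^-e g e f≢0) ⟩
  (f * inv g) ^ℤ e * f ^ℤ (ℤ.- e) * inv (bartholdiDet G q u)
    ≡⟨ *-assoc ((f * inv g) ^ℤ e) (f ^ℤ (ℤ.- e)) (inv (bartholdiDet G q u)) ⟩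
  (f * inv g) ^ℤ e * zeta G q u ∎
  where
  open ≡-Reasoning
  u′ : ℚ
  u′ = (1ℚ - fromℕ t) - u
  e : ℤ
  e = edgeExcess G
  f g : ℚ
  f = factor q u
  g = 1ℚ - (fromℕ t + u) ^ℕ 2 * q ^ℕ 2
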